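{- Let $G$ and $H$ be balanced signed graphs with intersecting vertex sets such that every edge of $G\cap H$ has the same sign in $G$ and in $H$, and let $G\cup H$ carry the signs inherited from $G$ and $H$. If $G\cap H$ is a consistent subgraph of $G$ and $H$, then $G\cup H$ is balanced.
   Context: A signed graph is a graph with a signature $\sigma:E\to\{+1,-1\}$; it is balanced if every circuit has an even number of negative edges. A balanced bipartition of a signed graph is a partition of its vertex set into two sets (either possibly empty) such that every edge between the two sets is negative and every edge within a set is positive; a signed graph is balanced iff it has a balanced bipartition. For balanced signed graphs $G$ and $H$, $G\cap H$ is called a consistent subgraph of $G$ and $H$ if $G\cap H$ has a balanced bipartition that extends both to a balanced bipartition of $G$ and to a balanced bipartition of $H$. -}

module Defs where

open import Data.Nat using (ℕ; zero; suc; _+_; _%_)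
open import Data.Nat.DivMod using (m%n<n)
open import Data.Nat.Divisibility using (_∣_)
open import Data.Fin using (Fin; zero; suc; toℕ; fromℕ<)
open import Data.Bool using (Bool; true; false; _∧_; _∨_; not; if_then_else_)
open import Data.Product using (_×_; _,_; proj₁; proj₂; Σ; ∃)
open import Data.Sum using (_⊎_)
open import Function.Definitions using (Injective)
open import Relation.Binary.PropositionalEquality using (_≡_)

data Sign : Set where
  pos neg : Sign

-- Ambient (multi)graph: vertices Fin n, edges Fin m, each edge e has endpoints
-- ends e (a pair; loops allowed, parallel edges allowed).  G, H, G∩H, G∪H are
-- all subgraphs of one ambient graph, so that vertices/edges are identified.
Ends : ℕ → ℕ → Set
Ends n m = Fin m → Fin n × Fin n

-- A signed subgraph of the ambient graph: vertex set, edge set, signature.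
-- The signature value on edges outside the edge set is irrelevant.
record SignedGraph (n m : ℕ) : Set where
  field
    inV  : Fin n → Bool
    inE  : Fin m → Bool
    sign : Fin m → Sign
open SignedGraph public

WellFormed : ∀ {n m} → Ends n m → SignedGraph n m → Set
WellFormed ends G = ∀ e → inE G e ≡ true →
  (inV G (proj₁ (ends e)) ≡ true) × (inV G (proj₂ (ends e)) ≡ true)

Joins : ∀ {n m} → Ends n m → Fin m → Fin n → Fin n → Set
Joins ends e u v = (ends e ≡ (u , v)) ⊎ (ends e ≡ (v , u))

next : ∀ {k} → Fin (suc k) → Fin (suc k)
next {k} i = fromℕ< (m%n<n (suc (toℕ i)) (suc k))

sumFin : ∀ {k} → (Fin k → ℕ) → ℕ
sumFin {zero}  f = 0
sumFin {suc k} f = f zero + sumFin (λ i → f (suc i))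

isNeg : Sign → ℕ
isNeg pos = 0
isNeg neg = 1

record Circuit {n m} (ends : Ends n m) (G : SignedGraph n m) (k : ℕ) : Set where
  field
    vs    : Fin (suc k) → Fin n
    es    : Fin (suc k) → Fin m
    vs-inj : Injective _≡_ _≡_ vs
    es-inj : Injective _≡_ _≡_ es
    vs-in : ∀ i → inV G (vs i) ≡ true
    es-in : ∀ i → inE G (es i) ≡ true
    joins : ∀ i → Joins ends (es i) (vs i) (vs (next i))
open Circuit public

negCount : ∀ {n m} {ends : Ends n m} {G : SignedGraph n m} {k} → Circuit ends G k → ℕ
negCount {G = G} C = sumFin (λ i → isNeg (sign G (es C i)))

Balanced : ∀ {n m} → Ends n m → SignedGraph n m → Set
Balanced ends G = ∀ k (C : Circuit ends G k) → 2 ∣ negCount C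

-- A bipartition of the vertex set of G is given by a side function
-- p : Fin n → Bool (values outside V(G) irrelevant); the two (possibly empty)
-- sets are {v ∈ V(G) | p v = true} and {v ∈ V(G) | p v = false}.
signFromSides : Bool → Bool → Sign
signFromSides true  true  = pos
signFromSides false false = pos
signFromSides true  false = neg
signFromSides false true  = neg

BalancedBipartition : ∀ {n m} → Ends n m → SignedGraph n m → (Fin n → Bool) → Set
BalancedBipartition ends G p = ∀ e → inE G e ≡ true →
  sign G e ≡ signFromSides (p (proj₁ (ends e))) (p (proj₂ (ends e)))

-- q (a bipartition of G ⊇ K) extends p (a bipartition of K), as unordered
-- partitions: on V(K) q agrees with p or with the swap of p.
Extends : ∀ {n m} → SignedGraph n m → (Fin n → Bool) → (Fin n → Bool) → Set
Extends K p q = (∀ v → inV K v ≡ true → q v ≡ p v)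
              ⊎ (∀ v → inV K v ≡ true → q v ≡ not (p v))

_∩ᵍ_ : ∀ {n m} → SignedGraph n m → SignedGraph n m → SignedGraph n m
G ∩ᵍ H = record { inV = λ v → inV G v ∧ inV H v
                ; inE = λ e → inE G e ∧ inE H e
                ; sign = sign G }

_∪ᵍ_ : ∀ {n m} → SignedGraph n m → SignedGraph n m → SignedGraph n m
G ∪ᵍ H = record { inV = λ v → inV G v ∨ inV H v
                ; inE = λ e → inE G e ∨ inE H e
                ; sign = λ e → if inE G e then sign G e else sign H e }

Consistent : ∀ {n m} → Ends n m → SignedGraph n m → SignedGraph n m → Set
Consistent {n} ends G H =
  Σ (Fin n → Bool) λ p → BalancedBipartition ends (G ∩ᵍ H) p
    × (Σ (Fin n → Bool) λ q → BalancedBipartition ends G q × Extends (G ∩ᵍ H) p q)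
    × (Σ (Fin n → Bool) λ r → BalancedBipartition ends H r × Extends (G ∩ᵍ H) p r)

-- A balanced bipartition of G ∪ H is obtained by gluing one of G and one of H.
-- Consistency gives bipartitions q of G and r of H that both extend the same
-- bipartition of G ∩ H; after swapping the two sides of r if necessary, q and r
-- coincide on V(G ∩ H). Put v on side q v if v ∈ V(G) and on side r v otherwise.
-- An edge of G ∪ H lies in G or in H together with its endpoints, where the glued
-- sides are those of q, resp. r, so its sign is right. Finally, a signed graph with
-- a balanced bipartition is balanced: the negative edges of a circuit are exactly
-- the places where it changes side, and a closed walk changes side an even number
-- of times.
module Submission where

open import Defs
open import Data.Nat using (ℕ; zero; suc; _+_; _%_; s≤s)
open import Data.Nat.DivMod using (m%n<n; n%n≡0; m<n⇒m%n≡m)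
open import Data.Nat.Divisibility using (_∣_; divides)
open import Data.Nat.Properties using (+-assoc; +-identityʳ)
open import Data.Fin using (Fin; zero; suc; toℕ; fromℕ; inject₁)
open import Data.Fin.Properties using (toℕ-injective; toℕ-fromℕ<; toℕ-inject₁; toℕ-fromℕ; toℕ<n)
open import Data.Bool using (Bool; true; false; not; _xor_; _∧_; if_then_else_)
open import Data.Bool.Properties
  using (not-involutive; not-distribˡ-xor; xor-assoc; xor-comm; xor-same)
open import Data.Product using (∃; _×_; _,_; proj₁; proj₂; Σ)
open import Data.Sum using (inj₁; inj₂)
open import Function using (_∘_)
open import Relation.Binary.PropositionalEquality
open ≡-Reasoning

isOdd : ℕ → Bool
isOdd zero    = false
isOdd (suc n) = not (isOdd n)

isOdd-+ : ∀ m n → isOdd (m + n) ≡ isOdd m xor isOdd n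
isOdd-+ zero    n = refl
isOdd-+ (suc m) n = trans (cong not (isOdd-+ m n)) (not-distribˡ-xor (isOdd m) (isOdd n))

¬isOdd⇒2∣ : ∀ n → isOdd n ≡ false → 2 ∣ n
¬isOdd⇒2∣ zero          _  = divides 0 refl
¬isOdd⇒2∣ (suc zero)    ()
¬isOdd⇒2∣ (suc (suc n)) eq with ¬isOdd⇒2∣ n (trans (sym (not-involutive (isOdd n))) eq)
... | divides q n≡q*2 = divides (suc q) (cong (λ x → suc (suc x)) n≡q*2)

xor-cancel-middle : ∀ a b c → (a xor b) xor (b xor c) ≡ a xor c
xor-cancel-middle a b c = begin
  (a xor b) xor (b xor c)  ≡⟨ xor-assoc a b (b xor c) ⟩
  a xor (b xor (b xor c))  ≡⟨ cong (a xor_) (sym (xor-assoc b b c)) ⟩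
  a xor ((b xor b) xor c)  ≡⟨ cong (λ x → a xor (x xor c)) (xor-same b) ⟩
  a xor c                  ∎

sumFin-cong : ∀ {k} {f g : Fin k → ℕ} → (∀ i → f i ≡ g i) → sumFin f ≡ sumFin g
sumFin-cong {zero}  f≗g = refl
sumFin-cong {suc k} f≗g = cong₂ _+_ (f≗g zero) (sumFin-cong (f≗g ∘ suc))

sumFin-fromℕ : ∀ k (f : Fin (suc k) → ℕ) → sumFin f ≡ sumFin (f ∘ inject₁) + f (fromℕ k)
sumFin-fromℕ zero    f = +-identityʳ (f zero)
sumFin-fromℕ (suc k) f =
  trans (cong (f zero +_) (sumFin-fromℕ k (f ∘ suc))) (sym (+-assoc (f zero) _ _))

next-inject₁ : ∀ {k} (j : Fin k) → next (inject₁ j) ≡ suc j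
next-inject₁ {k} j = toℕ-injective (begin
  toℕ (next (inject₁ j))        ≡⟨ toℕ-fromℕ< (m%n<n (suc (toℕ (inject₁ j))) (suc k)) ⟩
  suc (toℕ (inject₁ j)) % suc k ≡⟨ cong (λ x → suc x % suc k) (toℕ-inject₁ j) ⟩
  suc (toℕ j) % suc k           ≡⟨ m<n⇒m%n≡m (s≤s (toℕ<n j)) ⟩
  suc (toℕ j)                   ∎)

next-fromℕ : ∀ k → next (fromℕ k) ≡ zero
next-fromℕ k = toℕ-injective (begin
  toℕ (next (fromℕ k))        ≡⟨ toℕ-fromℕ< (m%n<n (suc (toℕ (fromℕ k))) (suc k)) ⟩
  suc (toℕ (fromℕ k)) % suc k ≡⟨ cong (λ x → suc x % suc k) (toℕ-fromℕ k) ⟩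
  suc k % suc k                ≡⟨ n%n≡0 (suc k) ⟩
  0                            ∎)

signFromSides-comm : ∀ a b → signFromSides a b ≡ signFromSides b a
signFromSides-comm true  true  = refl
signFromSides-comm true  false = refl
signFromSides-comm false true  = refl
signFromSides-comm false false = refl

signFromSides-not : ∀ a b → signFromSides (not a) (not b) ≡ signFromSides a b
signFromSides-not true  true  = refl
signFromSides-not true  false = refl
signFromSides-not false true  = refl
signFromSides-not false false = refl

sideChange : Bool → Bool → ℕ
sideChange a b = isNeg (signFromSides a b)

isOdd-sideChange : ∀ a b → isOdd (sideChange a b) ≡ a xor b
isOdd-sideChange true  true  = refl
isOdd-sideChange true  false = refl
isOdd-sideChange false true  = refl
isOdd-sideChange false false = refl

pathChanges : ∀ k → (Fin (suc k) → Bool) → ℕ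
pathChanges k g = sumFin {k} (λ j → sideChange (g (inject₁ j)) (g (suc j)))

isOdd-pathChanges : ∀ k (g : Fin (suc k) → Bool) →
  isOdd (pathChanges k g) ≡ g zero xor g (fromℕ k)
isOdd-pathChanges zero    g = sym (xor-same (g zero))
isOdd-pathChanges (suc k) g = begin
  isOdd (sideChange (g zero) (g (suc zero)) + pathChanges k (g ∘ suc))
    ≡⟨ isOdd-+ (sideChange (g zero) (g (suc zero))) (pathChanges k (g ∘ suc)) ⟩
  isOdd (sideChange (g zero) (g (suc zero))) xor isOdd (pathChanges k (g ∘ suc))
    ≡⟨ cong₂ _xor_ (isOdd-sideChange (g zero) (g (suc zero))) (isOdd-pathChanges k (g ∘ suc)) ⟩
  (g zero xor g (suc zero)) xor (g (suc zero) xor g (suc (fromℕ k)))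
    ≡⟨ xor-cancel-middle (g zero) (g (suc zero)) (g (suc (fromℕ k))) ⟩
  g zero xor g (suc (fromℕ k)) ∎

cycleChanges-even : ∀ k (g : Fin (suc k) → Bool) →
  2 ∣ sumFin (λ i → sideChange (g i) (g (next i)))
cycleChanges-even k g = ¬isOdd⇒2∣ _ (begin
  isOdd (sumFin change)
    ≡⟨ cong isOdd (sumFin-fromℕ k change) ⟩
  isOdd (sumFin (change ∘ inject₁) + change (fromℕ k))
    ≡⟨ isOdd-+ (sumFin (change ∘ inject₁)) (change (fromℕ k)) ⟩
  isOdd (sumFin (change ∘ inject₁)) xor isOdd (change (fromℕ k))
    ≡⟨ cong₂ (λ x y → isOdd x xor isOdd y)
         (sumFin-cong (λ j → cong (sideChange (g (inject₁ j)) ∘ g) (next-inject₁ j)))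
         (cong (sideChange (g (fromℕ k)) ∘ g) (next-fromℕ k)) ⟩
  isOdd (pathChanges k g) xor isOdd (sideChange (g (fromℕ k)) (g zero))
    ≡⟨ cong₂ _xor_ (isOdd-pathChanges k g) (isOdd-sideChange (g (fromℕ k)) (g zero)) ⟩
  (g zero xor g (fromℕ k)) xor (g (fromℕ k) xor g zero)
    ≡⟨ xor-cancel-middle (g zero) (g (fromℕ k)) (g zero) ⟩
  g zero xor g zero
    ≡⟨ xor-same (g zero) ⟩
  false ∎)
  where
  change : Fin (suc k) → ℕ
  change i = sideChange (g i) (g (next i))

balancedBipartition⇒balanced : ∀ {n m} (ends : Ends n m) (G : SignedGraph n m) p →
  BalancedBipartition ends G p → Balanced ends G
balancedBipartition⇒balanced ends G p bal k C =
  subst (2 ∣_) (sumFin-cong (sym ∘ negative⇔sideChange)) (cycleChanges-even k (p ∘ vs C))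
  where
  signAlong : Fin _ × Fin _ → Sign
  signAlong (u , v) = signFromSides (p u) (p v)

  negative⇔sideChange : ∀ i →
    isNeg (sign G (es C i)) ≡ sideChange (p (vs C i)) (p (vs C (next i)))
  negative⇔sideChange i with joins C i
  ... | inj₁ eq = cong isNeg (trans (bal (es C i) (es-in C i)) (cong signAlong eq))
  ... | inj₂ eq = cong isNeg (trans (bal (es C i) (es-in C i))
                    (trans (cong signAlong eq) (signFromSides-comm _ _)))

balancedBipartition-not : ∀ {n m} (ends : Ends n m) (G : SignedGraph n m) p →
  BalancedBipartition ends G p → BalancedBipartition ends G (not ∘ p)
balancedBipartition-not ends G p bal e e∈G = trans (bal e e∈G) (sym (signFromSides-not _ _))

extensions-align : ∀ {n m} (ends : Ends n m) (K H : SignedGraph n m) (p q r : Fin n → Bool) →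
  Extends K p q → Extends K p r → BalancedBipartition ends H r →
  Σ (Fin n → Bool) λ r′ → BalancedBipartition ends H r′ × (∀ v → inV K v ≡ true → r′ v ≡ q v)
extensions-align ends K H p q r (inj₁ q≗p) (inj₁ r≗p) bal =
  r , bal , λ v v∈K → trans (r≗p v v∈K) (sym (q≗p v v∈K))
extensions-align ends K H p q r (inj₂ q≗¬p) (inj₂ r≗¬p) bal =
  r , bal , λ v v∈K → trans (r≗¬p v v∈K) (sym (q≗¬p v v∈K))
extensions-align ends K H p q r (inj₁ q≗p) (inj₂ r≗¬p) bal =
  not ∘ r , balancedBipartition-not ends H r bal , λ v v∈K → begin
    not (r v)       ≡⟨ cong not (r≗¬p v v∈K) ⟩
    not (not (p v)) ≡⟨ not-involutive (p v) ⟩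
    p v             ≡⟨ sym (q≗p v v∈K) ⟩
    q v             ∎
extensions-align ends K H p q r (inj₂ q≗¬p) (inj₁ r≗p) bal =
  not ∘ r , balancedBipartition-not ends H r bal , λ v v∈K →
    trans (cong not (r≗p v v∈K)) (sym (q≗¬p v v∈K))

glueSides : ∀ {n m} → SignedGraph n m → (Fin n → Bool) → (Fin n → Bool) → Fin n → Bool
glueSides G q r v = if inV G v then q v else r v

balancedBipartition-∪ : ∀ {n m} (ends : Ends n m) (G H : SignedGraph n m) (q r : Fin n → Bool) →
  WellFormed ends G → WellFormed ends H →
  BalancedBipartition ends G q → BalancedBipartition ends H r →
  (∀ v → inV (G ∩ᵍ H) v ≡ true → r v ≡ q v) →
  BalancedBipartition ends (G ∪ᵍ H) (glueSides G q r)
balancedBipartition-∪ ends G H q r wfG wfH balG balH r≗q e e∈G∪H with inE G e in e∈G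
... | true rewrite proj₁ (wfG e e∈G) | proj₂ (wfG e e∈G) = balG e e∈G
... | false = trans (balH e e∈G∪H)
                (cong₂ signFromSides (glued≡r _ (proj₁ (wfH e e∈G∪H)))
                                     (glued≡r _ (proj₂ (wfH e e∈G∪H))))
  where
  glued≡r : ∀ v → inV H v ≡ true → r v ≡ glueSides G q r v
  glued≡r v v∈H with inV G v in v∈G
  ... | true  = r≗q v (cong₂ _∧_ v∈G v∈H)
  ... | false = refl

lemma8 : ∀ {n m} (ends : Ends n m) (G H : SignedGraph n m)
    → WellFormed ends G → WellFormed ends H
    → Balanced ends G → Balanced ends H
    → ∃ (λ v → (inV G v ≡ true) × (inV H v ≡ true))
    → (∀ e → inE G e ≡ true → inE H e ≡ true → sign G e ≡ sign H e)
    → Consistent ends G H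
    → Balanced ends (G ∪ᵍ H)
lemma8 ends G H wfG wfH _ _ _ _ (p , _ , (q , balG , q-ext) , (r , balH , r-ext))
  with extensions-align ends (G ∩ᵍ H) H p q r q-ext r-ext balH
... | r′ , balH′ , r′≗q =
  balancedBipartition⇒balanced ends (G ∪ᵍ H) (glueSides G q r′)
    (balancedBipartition-∪ ends G H q r′ wfG wfH balG balH′ r′≗q)
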